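{- Let $k\geq 2$ be an integer, let $G$ be a finite connected simple graph, and set $A_k=\lfloor\frac{k+1}{2}\rfloor$. Then $$A_k\gamma(G)\leq \gamma_k^s(G)\leq k\gamma(G).$$
   Context: $\gamma(G)$ is the domination number of $G$: the minimum size of a set $S\subseteq V(G)$ such that every vertex is in $S$ or adjacent to a vertex of $S$. For $f:V(G)\to\{0,1,\dots,k\}$ let $w(f)=\sum_{v}f(v)$; $f$ is a strong Roman $k$-dominating function ($k$-SRDF) if every vertex $u$ with $f(u)<k/2$ satisfies $f(u)+\sum_{v\in N_G(u),\, f(v)>k/2}f(v)\geq k$, where $N_G(u)$ is the open neighbourhood of $u$. $\gamma_k^s(G)$ is the minimum weight of a $k$-SRDF of $G$. -}

module Defs where

open import Data.Nat using (ℕ; zero; suc; _+_; _*_; _≤_; _<_; _/_)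
open import Data.Nat.Properties using (_<?_)
open import Data.Fin using (Fin; zero; suc)
open import Data.Bool using (Bool; true; false; if_then_else_; T)
open import Data.Product using (Σ; _×_; ∃)
open import Data.Sum using (_⊎_)
open import Data.Empty using (⊥)
open import Relation.Nullary using (¬_)
open import Relation.Nullary.Decidable using (⌊_⌋)
open import Relation.Binary.PropositionalEquality using (_≡_)

record Graph (n : ℕ) : Set where
  field
    adj     : Fin n → Fin n → Bool
    symm    : ∀ u v → adj u v ≡ adj v u
    irrefl  : ∀ v → adj v v ≡ false
open Graph public

sumFin : ∀ {n} → (Fin n → ℕ) → ℕ
sumFin {zero}  f = 0
sumFin {suc n} f = f zero + sumFin (λ i → f (suc i))

data Walk {n : ℕ} (G : Graph n) : Fin n → Fin n → Set where
  here : ∀ {u} → Walk G u u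
  step : ∀ {u w v} → T (adj G u w) → Walk G w v → Walk G u v

Connected : ∀ {n} → Graph n → Set
Connected {n} G = ∀ (u v : Fin n) → Walk G u v

Dominating : ∀ {n} → Graph n → (Fin n → Bool) → Set
Dominating {n} G S =
  ∀ (v : Fin n) → T (S v) ⊎ Σ (Fin n) (λ u → T (S u) × T (adj G v u))

size : ∀ {n} → (Fin n → Bool) → ℕ
size S = sumFin (λ v → if S v then 1 else 0)

IsDominationNumber : ∀ {n} → Graph n → ℕ → Set
IsDominationNumber {n} G d =
  Σ (Fin n → Bool) (λ S → Dominating G S × size S ≡ d)
  × (∀ (S : Fin n → Bool) → Dominating G S → d ≤ size S)

strongNbrSum : ∀ {n} → Graph n → ℕ → (Fin n → ℕ) → Fin n → ℕ
strongNbrSum G k f u =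
  sumFin (λ v → if adj G u v then (if ⌊ k <? 2 * f v ⌋ then f v else 0) else 0)

-- strong Roman k-dominating function f : V → {0,…,k}
-- (f(u) < k/2 is written 2 f(u) < k)
IsSRDF : ∀ {n} → ℕ → Graph n → (Fin n → ℕ) → Set
IsSRDF {n} k G f =
  (∀ v → f v ≤ k)
  × (∀ (u : Fin n) → 2 * f u < k → k ≤ f u + strongNbrSum G k f u)

weight : ∀ {n} → (Fin n → ℕ) → ℕ
weight f = sumFin f

IsSRDNumber : ∀ {n} → ℕ → Graph n → ℕ → Set
IsSRDNumber {n} k G s =
  Σ (Fin n → ℕ) (λ f → IsSRDF k G f × weight f ≡ s)
  × (∀ (f : Fin n → ℕ) → IsSRDF k G f → s ≤ weight f)

A : ℕ → ℕ
A k = (k + 1) / 2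

{-# OPTIONS --safe #-}
module Submission where

-- In a k-SRDF f the vertices with 2 f(v) ≥ k form a dominating set: a vertex
-- outside it has f(u) < k, so it must have a neighbour with f(v) > k/2. Each such vertex
-- carries weight at least ⌈k/2⌉ = A_k, whence A_k γ(G) ≤ γ_k^s(G). Conversely, putting
-- weight k on a dominating set and 0 elsewhere is a k-SRDF, whence γ_k^s(G) ≤ k γ(G).

open import Defs
open import Data.Nat using (ℕ; zero; suc; _≤_; _<_; _*_; _+_; z≤n; s≤s; z<s)
open import Data.Nat.Properties
open import Data.Nat.DivMod using (m<n*o⇒m/o<n)
open import Data.Fin using (Fin; zero; suc)
open import Data.Bool using (Bool; true; false; if_then_else_; T)
open import Data.Unit using (tt)
open import Data.Product using (_×_; _,_; ∃)
open import Data.Sum using (inj₁; inj₂)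
open import Relation.Nullary using (Dec; yes; no; contradiction)
open import Relation.Nullary.Decidable using (⌊_⌋; fromWitness; toWitness)
open import Relation.Binary.PropositionalEquality

sumFin-mono-≤ : ∀ {n} {f g : Fin n → ℕ} → (∀ v → f v ≤ g v) → sumFin f ≤ sumFin g
sumFin-mono-≤ {zero}  f≤g = z≤n
sumFin-mono-≤ {suc n} f≤g = +-mono-≤ (f≤g zero) (sumFin-mono-≤ (λ i → f≤g (suc i)))

sumFin-cong : ∀ {n} {f g : Fin n → ℕ} → (∀ v → f v ≡ g v) → sumFin f ≡ sumFin g
sumFin-cong {zero}  f≗g = refl
sumFin-cong {suc n} f≗g = cong₂ _+_ (f≗g zero) (sumFin-cong (λ i → f≗g (suc i)))

term≤sumFin : ∀ {n} (f : Fin n → ℕ) (v : Fin n) → f v ≤ sumFin f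
term≤sumFin f zero    = m≤m+n _ _
term≤sumFin f (suc v) = ≤-trans (term≤sumFin (λ i → f (suc i)) v) (m≤n+m _ _)

sumFin-*ˡ : ∀ {n} c (f : Fin n → ℕ) → sumFin (λ v → c * f v) ≡ c * sumFin f
sumFin-*ˡ {zero}  c f = sym (*-zeroʳ c)
sumFin-*ˡ {suc n} c f = begin
  c * f zero + sumFin (λ i → c * f (suc i))
    ≡⟨ cong (c * f zero +_) (sumFin-*ˡ c (λ i → f (suc i))) ⟩
  c * f zero + c * sumFin (λ i → f (suc i))
    ≡⟨ *-distribˡ-+ c (f zero) _ ⟨
  c * sumFin f ∎
  where open ≡-Reasoning

sumFin-positive : ∀ {n} (f : Fin n → ℕ) → 0 < sumFin f → ∃ λ v → 0 < f v
sumFin-positive {zero}  f ()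
sumFin-positive {suc n} f pos with f zero in eq
... | suc _ = zero , subst (0 <_) (sym eq) z<s
... | zero  = let v , fv>0 = sumFin-positive (λ i → f (suc i)) pos in suc v , fv>0

scaledChar : ∀ {n} → ℕ → (Fin n → Bool) → Fin n → ℕ
scaledChar c S v = if S v then c else 0

scaledChar-∈ : ∀ {n} c (S : Fin n → Bool) {v} → T (S v) → scaledChar c S v ≡ c
scaledChar-∈ c S {v} v∈S with S v
... | true = refl

weight-scaledChar : ∀ {n} c (S : Fin n → Bool) → weight (scaledChar c S) ≡ c * size S
weight-scaledChar c S = trans (sumFin-cong pointwise) (sumFin-*ˡ c (λ v → if S v then 1 else 0))
  where
  pointwise : ∀ v → scaledChar c S v ≡ c * (if S v then 1 else 0)
  pointwise v with S v
  ... | true  = sym (*-identityʳ c)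
  ... | false = sym (*-zeroʳ c)

*-size≤weight : ∀ {n} c (S : Fin n → Bool) (f : Fin n → ℕ) →
                (∀ v → T (S v) → c ≤ f v) → c * size S ≤ weight f
*-size≤weight c S f c≤f =
  subst (_≤ weight f) (weight-scaledChar c S) (sumFin-mono-≤ pointwise)
  where
  pointwise : ∀ v → scaledChar c S v ≤ f v
  pointwise v with S v | c≤f v
  ... | true  | c≤fv = c≤fv tt
  ... | false | _    = z≤n

k≤2*x⇒A≤x : ∀ {k x} → k ≤ 2 * x → A k ≤ x
k≤2*x⇒A≤x {k} {x} k≤2x = <⇒≤pred (m<n*o⇒m/o<n {k + 1} {suc x} {2} k+1<2[x+1])
  where
  k+1<2[x+1] : k + 1 < suc x * 2
  k+1<2[x+1] = subst₂ _<_ (+-comm 1 k) (cong (λ y → suc (suc y)) (*-comm 2 x)) (s≤s (s≤s k≤2x))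

module _ {n} (G : Graph n) (k : ℕ) (f : Fin n → ℕ) where

  strong-neighbour≤strongNbrSum : ∀ {u w} → T (adj G u w) → k < 2 * f w →
                                  f w ≤ strongNbrSum G k f u
  strong-neighbour≤strongNbrSum {u} {w} uw k<2fw =
    ≤-trans (summand (adj G u w) uw) (term≤sumFin _ w)
    where
    summand : ∀ a → T a → f w ≤ (if a then (if ⌊ k <? 2 * f w ⌋ then f w else 0) else 0)
    summand true _ with k <? 2 * f w
    ... | yes _      = ≤-refl
    ... | no k≮2fw   = contradiction k<2fw k≮2fw

  strongNbrSum-positive : ∀ u → 0 < strongNbrSum G k f u →
                          ∃ λ w → T (adj G u w) × k < 2 * f w
  strongNbrSum-positive u pos with sumFin-positive _ pos
  ... | w , summand>0 = w , summand (adj G u w) (k <? 2 * f w) summand>0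
    where
    summand : ∀ a (k<?2fw : Dec (k < 2 * f w)) →
              0 < (if a then (if ⌊ k<?2fw ⌋ then f w else 0) else 0) → T a × k < 2 * f w
    summand true (yes k<2fw) _ = tt , k<2fw

heavy : ∀ {n} → ℕ → (Fin n → ℕ) → Fin n → Bool
heavy k f v = ⌊ k ≤? 2 * f v ⌋

light⇒strong-neighbour : ∀ {n k} (G : Graph n) {f : Fin n → ℕ} → IsSRDF k G f →
                         ∀ v → 2 * f v < k → ∃ λ w → T (adj G v w) × k < 2 * f w
light⇒strong-neighbour {k = k} G {f} (_ , strong) v 2fv<k =
  strongNbrSum-positive G k f v (+-cancelˡ-< (f v) 0 _ fv+0<fv+sum)
  where
  open ≤-Reasoning
  fv+0<fv+sum : f v + 0 < f v + strongNbrSum G k f v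
  fv+0<fv+sum = begin-strict
    f v + 0                    ≡⟨ +-identityʳ (f v) ⟩
    f v                        ≤⟨ m≤m+n (f v) (f v + 0) ⟩
    2 * f v                    <⟨ 2fv<k ⟩
    k                          ≤⟨ strong v 2fv<k ⟩
    f v + strongNbrSum G k f v ∎

heavy-dominating : ∀ {n k} (G : Graph n) {f : Fin n → ℕ} → IsSRDF k G f → Dominating G (heavy k f)
heavy-dominating {k = k} G {f} f-srdf v with k ≤? 2 * f v
... | yes _      = inj₁ tt
... | no k≰2fv  with light⇒strong-neighbour G f-srdf v (≰⇒> k≰2fv)
...   | w , vw , k<2fw = inj₂ (w , fromWitness (<⇒≤ k<2fw) , vw)

A*size-heavy≤weight : ∀ {n} k (f : Fin n → ℕ) → A k * size (heavy k f) ≤ weight f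
A*size-heavy≤weight k f =
  *-size≤weight (A k) (heavy k f) f (λ v v-heavy → k≤2*x⇒A≤x (toWitness v-heavy))

dominating⇒SRDF : ∀ {n k} (G : Graph n) {S : Fin n → Bool} → 0 < k → Dominating G S →
                  IsSRDF k G (scaledChar k S)
dominating⇒SRDF {n} {k} G {S} 0<k dom = bounded , strong
  where
  g : Fin n → ℕ
  g = scaledChar k S
  k<2g : ∀ {v} → T (S v) → k < 2 * g v
  k<2g {v} v∈S rewrite scaledChar-∈ k S v∈S =
    subst (k <_) (cong (k +_) (sym (+-identityʳ k))) (m<m+n k 0<k)
  bounded : ∀ v → g v ≤ k
  bounded v with S v
  ... | true  = ≤-refl
  ... | false = z≤n
  strong : ∀ u → 2 * g u < k → k ≤ g u + strongNbrSum G k g u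
  strong u 2gu<k with dom u
  ... | inj₁ u∈S = contradiction (k<2g u∈S) (<-asym 2gu<k)
  ... | inj₂ (w , w∈S , uw) = begin
    k                          ≡⟨ scaledChar-∈ k S w∈S ⟨
    g w                        ≤⟨ strong-neighbour≤strongNbrSum G k g uw (k<2g w∈S) ⟩
    strongNbrSum G k g u       ≤⟨ m≤n+m _ (g u) ⟩
    g u + strongNbrSum G k g u ∎
    where open ≤-Reasoning

proposition2p2 : (k : ℕ) → 2 ≤ k → (n : ℕ) → (G : Graph n) → Connected G →
    (d s : ℕ) → IsDominationNumber G d → IsSRDNumber k G s →
    (A k * d ≤ s) × (s ≤ k * d)
proposition2p2 k 2≤k n G _ d s ((S₀ , S₀-dom , size-S₀≡d) , γ-min) ((f₀ , f₀-srdf , weight-f₀≡s) , γˢ-min) =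
  lower , upper
  where
  open ≤-Reasoning
  lower : A k * d ≤ s
  lower = begin
    A k * d                  ≤⟨ *-monoʳ-≤ (A k) (γ-min (heavy k f₀) (heavy-dominating G f₀-srdf)) ⟩
    A k * size (heavy k f₀)  ≤⟨ A*size-heavy≤weight k f₀ ⟩
    weight f₀                ≡⟨ weight-f₀≡s ⟩
    s                        ∎
  upper : s ≤ k * d
  upper = begin
    s                        ≤⟨ γˢ-min (scaledChar k S₀) (dominating⇒SRDF G (≤-trans (s≤s z≤n) 2≤k) S₀-dom) ⟩
    weight (scaledChar k S₀) ≡⟨ weight-scaledChar k S₀ ⟩
    k * size S₀              ≡⟨ cong (k *_) size-S₀≡d ⟩
    k * d                    ∎
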